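{- Let $\alpha = c + d\rho \in \mathbb{Z}[\rho]$ with $7 \le N(\alpha) \equiv 1 \pmod 6$, and suppose $\alpha$ is not an associate of any (rational) integer. Let $\ell = \gcd(c,d)$, $c' = c/\ell$, $d' = d/\ell$ and $\alpha' = c' + d'\rho$. Then $EJ_\alpha$ is an $\ell^2$-fold cover of a 6-valent first-kind Frobenius circulant that is isomorphic to $EJ_{\alpha'}$.
   Context: $\rho=(1+\sqrt{ -3})/2$; $\mathbb{Z}[\rho]$ is the ring of Eisenstein-Jacobi integers with norm $N(x+y\rho)=x^2+xy+y^2$; $\alpha,\beta$ are associates if $\alpha=\beta\rho^j$ for some integer $j$. For $N(\gamma)\ge 7$, $EJ_\gamma$ is the Cayley graph on the additive group of $\mathbb{Z}[\rho]/(\gamma)$ with connection set the residue classes of $\pm1,\pm\rho,\pm\rho^2$. A $k$-fold cover of $\Gamma_2$ is a graph $\Gamma_1$ with a surjection $V(\Gamma_1)\to V(\Gamma_2)$ that is a bijection from each neighbourhood $N(u)$ onto $N(\phi(u))$ and has all fibres of size $k$. A Frobenius group is a transitive non-regular finite permutation group in which only the identity fixes two points; it is $K\rtimes H$ with regular normal kernel $K$ and point stabiliser $H$ acting by conjugation. A first-kind Frobenius graph is $\mathrm{Cay}(K,a^H)$ with $\langle a^H\rangle = K$ and $|H|$ even or $a$ an involution; a 6-valent first-kind Frobenius circulant is such a 6-valent graph with $K$ cyclic. -}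

module Defs where

open import Level using (0ℓ)
open import Data.Nat as ℕ using (ℕ; zero; suc)
open import Data.Integer as ℤ using (ℤ; +_; _+_; _-_; _*_; -_)
open import Data.Fin using (Fin; toℕ)
open import Data.Sum using (_⊎_)
open import Data.Product using (Σ; ∃; _×_; _,_)
open import Relation.Binary.PropositionalEquality using (_≡_)
open import Relation.Binary.Structures using (IsEquivalence)
open import Relation.Nullary using (¬_)

-- Eisenstein–Jacobi integers  x + yρ  with ρ = (1+√-3)/2, ρ² = ρ - 1

record EJInt : Set where
  constructor _+_ρ
  field
    re : ℤ
    im : ℤ
open EJInt public

infixl 6 _⊕_ _⊖_
infixl 7 _⊗_

_⊕_ : EJInt → EJInt → EJInt
(a + b ρ) ⊕ (c + d ρ) = (a + c) + (b + d) ρ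

_⊖_ : EJInt → EJInt → EJInt
(a + b ρ) ⊖ (c + d ρ) = (a - c) + (b - d) ρ

-- (a+bρ)(c+dρ) = ac + (ad+bc)ρ + bdρ² = (ac - bd) + (ad + bc + bd)ρ
_⊗_ : EJInt → EJInt → EJInt
(a + b ρ) ⊗ (c + d ρ) = (a * c - b * d) + (a * d + b * c + b * d) ρ

ρ′ : EJInt
ρ′ = (+ 0) + (+ 1) ρ

one : EJInt
one = (+ 1) + (+ 0) ρ

ρ^ : ℕ → EJInt
ρ^ zero    = one
ρ^ (suc j) = ρ^ j ⊗ ρ′

ι : ℤ → EJInt
ι m = m + (+ 0) ρ

N : EJInt → ℤ
N (x + y ρ) = x * x + x * y + y * y

-- α and β are associates iff α = β ρ^j for some integer j
-- (ρ has order 6, so j ranges over ℕ without loss)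
Associates : EJInt → EJInt → Set
Associates α β = ∃ λ (j : ℕ) → α ≡ β ⊗ ρ^ j

AssociateOfInteger : EJInt → Set
AssociateOfInteger α = ∃ λ (m : ℤ) → Associates α (ι m)

-- Graphs whose vertex set is a setoid (used to model quotients)

record Graph : Set₁ where
  field
    V       : Set
    _≈_     : V → V → Set
    E       : V → V → Set

-- A predicate P on a type with equivalence ≈ (P respecting ≈ is not
-- required) has exactly k elements up to ≈.
HasCard : {A : Set} → (A → A → Set) → (A → Set) → ℕ → Set
HasCard {A} _≈_ P k =
  Σ (Fin k → A) λ f →
    (∀ i → P (f i)) ×
    (∀ i j → f i ≈ f j → i ≡ j) ×
    (∀ x → P x → ∃ λ i → x ≈ f i)

record Cover (k : ℕ) (Γ₁ Γ₂ : Graph) : Set where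
  module G₁ = Graph Γ₁
  module G₂ = Graph Γ₂
  field
    φ       : G₁.V → G₂.V
    φ-cong  : ∀ {x y} → x G₁.≈ y → φ x G₂.≈ φ y
    nb-map  : ∀ u w → G₁.E u w → G₂.E (φ u) (φ w)
    nb-inj  : ∀ u w w′ → G₁.E u w → G₁.E u w′ → φ w G₂.≈ φ w′ → w G₁.≈ w′
    nb-surj : ∀ u z → G₂.E (φ u) z → ∃ λ w → G₁.E u w × (φ w G₂.≈ z)
    fibres  : ∀ v → HasCard G₁._≈_ (λ u → φ u G₂.≈ v) k

record Iso (Γ₁ Γ₂ : Graph) : Set where
  module G₁ = Graph Γ₁
  module G₂ = Graph Γ₂
  field
    f      : G₁.V → G₂.V
    g      : G₂.V → G₁.V
    f-cong : ∀ {x y} → x G₁.≈ y → f x G₂.≈ f y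
    g-cong : ∀ {x y} → x G₂.≈ y → g x G₁.≈ g y
    fg     : ∀ y → f (g y) G₂.≈ y
    gf     : ∀ x → g (f x) G₁.≈ x
    f-E    : ∀ x y → G₁.E x y → G₂.E (f x) (f y)
    g-E    : ∀ x y → G₂.E x y → G₁.E (g x) (g y)

-- EJ_γ : Cayley graph on ℤ[ρ]/(γ) with connection set ±1, ±ρ, ±ρ²
-- (= {ρ^j : 0 ≤ j < 6})

ModEJ : EJInt → EJInt → EJInt → Set
ModEJ γ x y = ∃ λ q → x ⊖ y ≡ q ⊗ γ

EJ : EJInt → Graph
EJ γ = record
  { V   = EJInt
  ; _≈_ = ModEJ γ
  ; E   = λ x y → ∃ λ (j : Fin 6) → ModEJ γ y (x ⊕ ρ^ (toℕ j))
  }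

-- Cyclic group ℤ_n modelled as ℤ modulo n

ModEq : ℕ → ℤ → ℤ → Set
ModEq n x y = ∃ λ (q : ℤ) → x - y ≡ q * + n

data Generated (n : ℕ) (S : ℤ → Set) : ℤ → Set where
  gen-0   : Generated n S (+ 0)
  gen-add : ∀ {x s} → Generated n S x → S s → Generated n S (x + s)
  gen-sub : ∀ {x s} → Generated n S x → S s → Generated n S (x - s)
  gen-mod : ∀ {x y} → Generated n S x → ModEq n x y → Generated n S y

Cay : (n : ℕ) → (ℤ → Set) → Graph
Cay n S = record
  { V   = ℤ
  ; _≈_ = ModEq n
  ; E   = λ x y → ∃ λ s → S s × ModEq n y (x + s)
  }

-- H ⊆ Aut(ℤ_n) (acting by multiplication by units), given as a
-- predicate on ℤ read modulo n, is a subgroup, and the group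
-- K ⋊ H = {x ↦ h x + k} acting on K = ℤ_n is a Frobenius group:
-- non-regular and only the identity fixes two points.
record IsFrobeniusCyclic (n : ℕ) (H : ℤ → Set) : Set where
  field
    n-pos    : 0 ℕ.< n
    H-resp   : ∀ {h h′} → ModEq n h h′ → H h → H h′
    H-one    : H (+ 1)
    H-mul    : ∀ {h h′} → H h → H h′ → H (h * h′)
    H-unit   : ∀ {h} → H h → ∃ λ h′ → H h′ × ModEq n (h * h′) (+ 1)
    -- transitive but not regular: some non-identity element fixes a point
    nonreg   : ∃ λ h → H h × ¬ ModEq n h (+ 1)
    frob     : ∀ h k x y → H h → ¬ ModEq n x y →
               ModEq n (h * x + k) x → ModEq n (h * y + k) y →
               ModEq n h (+ 1) × ModEq n k (+ 0)

Orbit : ℕ → (ℤ → Set) → ℤ → ℤ → Set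
Orbit n H a x = ∃ λ h → H h × ModEq n x (h * a)

record FirstKindFrobCirc6 (n : ℕ) (H : ℤ → Set) (a : ℤ) : Set where
  field
    frobenius : IsFrobeniusCyclic n H
    generates : ∀ x → Generated n (Orbit n H a) x
    kind      : (∃ λ m → HasCard (ModEq n) H (2 ℕ.* m))
                ⊎ (¬ ModEq n a (+ 0) × ModEq n (a + a) (+ 0))
    six       : HasCard (ModEq n) (Orbit n H a) 6

module Submission where

-- Write n = N(α′) ≥ 2; 6 is invertible modulo n because ℓ²n ≡ 1 (mod 6).
-- From a Bézout identity s c′ + t d′ = 1 we get an integer r that is a common
-- root of c′ + d′X and X² - X + 1 modulo n, so evaluation at r,
-- φ(x + yρ) = x + yr, is a ring map ℤ[ρ] → ℤ/n with kernel exactly (α′).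
-- It carries the six units ρ^j to a subgroup H = {u_j} of (ℤ/n)ˣ of order 6;
-- differences of distinct units have norm 1, 3 or 4, hence stay invertible, which
-- makes ℤ/n ⋊ H a Frobenius group.  Then φ induces EJ_α′ ≅ Cay(ℤ/n, 1^H), and,
-- since the fibres of φ on ℤ[ρ]/(α′ℓ) are translates of ℤ[ρ]/(ℓ) (ℓ² classes),
-- an ℓ²-fold covering EJ_α → Cay(ℤ/n, 1^H).

open import Defs
open import Data.Nat as ℕ using (ℕ; zero; suc; _^_)
import Data.Nat.Properties as ℕP
open import Data.Integer as ℤ using (ℤ; +_; -[1+_]; +[1+_]; _+_; _-_; _*_; -_; ∣_∣; _≤_)
import Data.Integer.Properties as ℤP
open import Data.Integer.Tactic.RingSolver using (solve; solve-∀)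
open import Data.Nat.GCD using (gcd; gcd-GCD; module Bézout)
open import Data.Fin using (Fin; toℕ; zero; suc; combine; remQuot; fromℕ<)
open import Data.Fin.Properties using (all?; any?)
import Data.Fin.Properties as FinP
open import Data.Sum as Sum using (_⊎_; inj₁; inj₂)
open import Data.Product using (∃; _×_; _,_; proj₁; proj₂; uncurry)
open import Data.List using (_∷_; [])
open import Data.Empty using (⊥-elim)
open import Data.Unit using (⊤; tt)
open import Function using (_∘_; id)
open import Data.Integer.DivMod using (_%ℕ_; _/ℕ_; a≡a%ℕn+[a/ℕn]*n; n%ℕd<d)
open import Relation.Nullary using (¬_)
open import Relation.Nullary.Decidable using (toWitness; map′; _×-dec_; _⊎-dec_)
open import Relation.Binary.Definitions using (DecidableEquality)
open import Relation.Binary.PropositionalEquality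

-- Arithmetic in ℤ[ρ]

ej≡ : ∀ {a b c d} → a ≡ c → b ≡ d → (a + b ρ) ≡ (c + d ρ)
ej≡ refl refl = refl

-- Complex conjugation: ρ̄ = 1 - ρ, so  x + yρ ↦ (x + y) - yρ.
conj : EJInt → EJInt
conj (x + y ρ) = (x + y) + (- y) ρ

infixl 7 _·_
_·_ : ℤ → EJInt → EJInt
m · (x + y ρ) = (m * x) + (m * y) ρ

⊗-comm : ∀ a b → a ⊗ b ≡ b ⊗ a
⊗-comm (x + y ρ) (u + v ρ) = ej≡ (solve (x ∷ y ∷ u ∷ v ∷ [])) (solve (x ∷ y ∷ u ∷ v ∷ []))

conj-⊗ : ∀ a x → conj a ⊗ (a ⊗ x) ≡ N a · x
conj-⊗ (a + b ρ) (x + y ρ) = ej≡ (real a b x y) (imag a b x y)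
  where
  real : ∀ a b x y → (a + b) * (a * x - b * y) - (- b) * (a * y + b * x + b * y)
                     ≡ (a * a + a * b + b * b) * x
  real = solve-∀
  imag : ∀ a b x y → (a + b) * (a * y + b * x + b * y) + (- b) * (a * x - b * y)
                     + (- b) * (a * y + b * x + b * y) ≡ (a * a + a * b + b * b) * y
  imag = solve-∀

N-conj : ∀ a → N (conj a) ≡ N a
N-conj (a + b ρ) = norm a b
  where
  norm : ∀ a b → (a + b) * (a + b) + (a + b) * (- b) + (- b) * (- b) ≡ a * a + a * b + b * b
  norm = solve-∀

·-cancel : ∀ m .{{_ : ℤ.NonZero m}} {x y} → m · x ≡ m · y → x ≡ y
·-cancel m {x + y ρ} {u + v ρ} e =
  ej≡ (ℤP.*-cancelˡ-≡ m x u (cong re e)) (ℤP.*-cancelˡ-≡ m y v (cong im e))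

⊗-cancelˡ : ∀ a .{{_ : ℤ.NonZero (N a)}} {x y} → a ⊗ x ≡ a ⊗ y → x ≡ y
⊗-cancelˡ a {x} {y} e = ·-cancel (N a) (begin
  N a · x               ≡⟨ sym (conj-⊗ a x) ⟩
  conj a ⊗ (a ⊗ x)      ≡⟨ cong (conj a ⊗_) e ⟩
  conj a ⊗ (a ⊗ y)      ≡⟨ conj-⊗ a y ⟩
  N a · y               ∎)
  where open ≡-Reasoning

ModEJ-refl : ∀ γ x → ModEJ γ x x
ModEJ-refl (g + h ρ) (x + y ρ) = (+ 0) + (+ 0) ρ , ej≡ (ℤP.+-inverseʳ x) (ℤP.+-inverseʳ y)

ModEJ-sym : ∀ γ {x y} → ModEJ γ x y → ModEJ γ y x
ModEJ-sym (g + h ρ) {x₁ + x₂ ρ} {y₁ + y₂ ρ} ((q₁ + q₂ ρ) , e) =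
  (- q₁) + (- q₂) ρ , ej≡ (real (cong re e)) (imag (cong im e))
  where
  open ≡-Reasoning
  real : x₁ - y₁ ≡ q₁ * g - q₂ * h → y₁ - x₁ ≡ (- q₁) * g - (- q₂) * h
  real e = begin
    y₁ - x₁                ≡⟨ solve (x₁ ∷ y₁ ∷ []) ⟩
    - (x₁ - y₁)            ≡⟨ cong -_ e ⟩
    - (q₁ * g - q₂ * h)    ≡⟨ solve (q₁ ∷ q₂ ∷ g ∷ h ∷ []) ⟩
    (- q₁) * g - (- q₂) * h ∎
  imag : x₂ - y₂ ≡ q₁ * h + q₂ * g + q₂ * h → y₂ - x₂ ≡ (- q₁) * h + (- q₂) * g + (- q₂) * h
  imag e = begin
    y₂ - x₂                          ≡⟨ solve (x₂ ∷ y₂ ∷ []) ⟩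
    - (x₂ - y₂)                      ≡⟨ cong -_ e ⟩
    - (q₁ * h + q₂ * g + q₂ * h)     ≡⟨ solve (q₁ ∷ q₂ ∷ g ∷ h ∷ []) ⟩
    (- q₁) * h + (- q₂) * g + (- q₂) * h ∎

ModEJ-trans : ∀ γ {x y z} → ModEJ γ x y → ModEJ γ y z → ModEJ γ x z
ModEJ-trans (g + h ρ) {x₁ + x₂ ρ} {y₁ + y₂ ρ} {z₁ + z₂ ρ} ((q₁ + q₂ ρ) , e) ((p₁ + p₂ ρ) , f) =
  (q₁ + p₁) + (q₂ + p₂) ρ , ej≡ (real (cong re e) (cong re f)) (imag (cong im e) (cong im f))
  where
  open ≡-Reasoning
  real : x₁ - y₁ ≡ q₁ * g - q₂ * h → y₁ - z₁ ≡ p₁ * g - p₂ * h →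
         x₁ - z₁ ≡ (q₁ + p₁) * g - (q₂ + p₂) * h
  real e f = begin
    x₁ - z₁                                  ≡⟨ solve (x₁ ∷ y₁ ∷ z₁ ∷ []) ⟩
    (x₁ - y₁) + (y₁ - z₁)                    ≡⟨ cong₂ _+_ e f ⟩
    (q₁ * g - q₂ * h) + (p₁ * g - p₂ * h)    ≡⟨ solve (q₁ ∷ q₂ ∷ p₁ ∷ p₂ ∷ g ∷ h ∷ []) ⟩
    (q₁ + p₁) * g - (q₂ + p₂) * h            ∎
  imag : x₂ - y₂ ≡ q₁ * h + q₂ * g + q₂ * h → y₂ - z₂ ≡ p₁ * h + p₂ * g + p₂ * h →
         x₂ - z₂ ≡ (q₁ + p₁) * h + (q₂ + p₂) * g + (q₂ + p₂) * h
  imag e f = begin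
    x₂ - z₂                                                  ≡⟨ solve (x₂ ∷ y₂ ∷ z₂ ∷ []) ⟩
    (x₂ - y₂) + (y₂ - z₂)                                    ≡⟨ cong₂ _+_ e f ⟩
    (q₁ * h + q₂ * g + q₂ * h) + (p₁ * h + p₂ * g + p₂ * h)  ≡⟨ solve (q₁ ∷ q₂ ∷ p₁ ∷ p₂ ∷ g ∷ h ∷ []) ⟩
    (q₁ + p₁) * h + (q₂ + p₂) * g + (q₂ + p₂) * h            ∎

conj-norm : ∀ a → conj a ⊗ a ≡ ι (N a)
conj-norm (a + b ρ) = ej≡ (real a b) (imag a b)
  where
  real : ∀ a b → (a + b) * a - (- b) * b ≡ a * a + a * b + b * b
  real = solve-∀
  imag : ∀ a b → (a + b) * b + (- b) * a + (- b) * b ≡ + 0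
  imag = solve-∀

⊗-rotate : ∀ q a b → q ⊗ (a ⊗ b) ≡ a ⊗ (q ⊗ b)
⊗-rotate (q + p ρ) (a + b ρ) (x + y ρ) = ej≡ (real q p a b x y) (imag q p a b x y)
  where
  real : ∀ q p a b x y → q * (a * x - b * y) - p * (a * y + b * x + b * y)
                         ≡ a * (q * x - p * y) - b * (q * y + p * x + p * y)
  real = solve-∀
  imag : ∀ q p a b x y → q * (a * y + b * x + b * y) + p * (a * x - b * y) + p * (a * y + b * x + b * y)
                         ≡ a * (q * y + p * x + p * y) + b * (q * x - p * y) + b * (q * y + p * x + p * y)
  imag = solve-∀

⊕-⊖-cancel : ∀ w z → w ⊕ (z ⊖ w) ≡ z
⊕-⊖-cancel (a + b ρ) (x + y ρ) = ej≡ (cancel a x) (cancel b y)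
  where
  cancel : ∀ a x → a + (x - a) ≡ x
  cancel = solve-∀

translate-⊖ : ∀ v a q q′ → (v ⊕ a ⊗ q) ⊖ (v ⊕ a ⊗ q′) ≡ a ⊗ (q ⊖ q′)
translate-⊖ (v + w ρ) (a + b ρ) (x + y ρ) (x′ + y′ ρ) = ej≡ (real v a b x y x′ y′) (imag w a b x y x′ y′)
  where
  real : ∀ v a b x y x′ y′ → (v + (a * x - b * y)) - (v + (a * x′ - b * y′))
                             ≡ a * (x - x′) - b * (y - y′)
  real = solve-∀
  imag : ∀ w a b x y x′ y′ → (w + (a * y + b * x + b * y)) - (w + (a * y′ + b * x′ + b * y′))
                             ≡ a * (y - y′) + b * (x - x′) + b * (y - y′)
  imag = solve-∀

⊗-ι : ∀ q m → q ⊗ ι m ≡ m · q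
⊗-ι (x + y ρ) m = ej≡ (real x y m) (imag x y m)
  where
  real : ∀ x y m → x * m - y * + 0 ≡ m * x
  real = solve-∀
  imag : ∀ x y m → x * + 0 + y * m + y * + 0 ≡ m * y
  imag = solve-∀

sq : ℤ → ℕ
sq z = ∣ z ∣ ℕ.* ∣ z ∣

square : ∀ z → z * z ≡ + sq z
square (+ k)    = ℤP.+◃n≡+n (k ℕ.* k)
square -[1+ k ] = ℤP.+◃n≡+n (sq -[1+ k ])

twice-norm : ∀ x y → + 2 * N (x + y ρ) ≡ + (sq x ℕ.+ sq y ℕ.+ sq (x + y))
twice-norm x y = begin
  + 2 * (x * x + x * y + y * y)              ≡⟨ solve (x ∷ y ∷ []) ⟩
  x * x + y * y + (x + y) * (x + y)          ≡⟨ cong₂ _+_ (cong₂ _+_ (square x) (square y)) (square (x + y)) ⟩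
  + sq x + + sq y + + sq (x + y)             ≡⟨ cong (_+ + sq (x + y)) (sym (ℤP.pos-+ (sq x) (sq y))) ⟩
  + (sq x ℕ.+ sq y) + + sq (x + y)           ≡⟨ sym (ℤP.pos-+ (sq x ℕ.+ sq y) (sq (x + y))) ⟩
  + (sq x ℕ.+ sq y ℕ.+ sq (x + y))           ∎
  where open ≡-Reasoning

norm-nonneg : ∀ a → ∃ λ m → N a ≡ + m
norm-nonneg (x + y ρ) with N (x + y ρ) in eq
... | + m      = m , refl
... | -[1+ k ] = ⊥-elim (negative (trans (cong (+ 2 *_) (sym eq)) (twice-norm x y)))
  where
  negative : ∀ {m} → + 2 * -[1+ k ] ≢ + m
  negative ()

norm-one : ∀ a → N a ≡ + 1 → ∃ λ j → a ≡ ρ^ j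
norm-one (x + y ρ) N≡1 = small-units x y (root≤1 ∣ x ∣ sqx≤2) (root≤1 ∣ y ∣ sqy≤2) N≡1
  where
  two≡ : 2 ≡ sq x ℕ.+ sq y ℕ.+ sq (x + y)
  two≡ = ℤP.+-injective (trans (cong (+ 2 *_) (sym N≡1)) (twice-norm x y))
  sqx≤2 : sq x ℕ.≤ 2
  sqx≤2 = ℕP.≤-trans (ℕP.≤-trans (ℕP.m≤m+n (sq x) (sq y)) (ℕP.m≤m+n _ (sq (x + y)))) (ℕP.≤-reflexive (sym two≡))
  sqy≤2 : sq y ℕ.≤ 2
  sqy≤2 = ℕP.≤-trans (ℕP.≤-trans (ℕP.m≤n+m (sq y) (sq x)) (ℕP.m≤m+n _ (sq (x + y)))) (ℕP.≤-reflexive (sym two≡))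
  root≤1 : ∀ a → a ℕ.* a ℕ.≤ 2 → a ℕ.≤ 1
  root≤1 zero          _ = ℕ.z≤n
  root≤1 (suc zero)    _ = ℕ.s≤s ℕ.z≤n
  root≤1 (suc (suc a)) (ℕ.s≤s (ℕ.s≤s h)) with ℕP.≤-trans (ℕP.m≤n+m (suc a ℕ.* suc (suc a)) a) h
  ... | ()
  small-units : ∀ x y → ∣ x ∣ ℕ.≤ 1 → ∣ y ∣ ℕ.≤ 1 → N (x + y ρ) ≡ + 1 → ∃ λ j → (x + y ρ) ≡ ρ^ j
  small-units (+ suc (suc k)) y (ℕ.s≤s ()) _ _
  small-units -[1+ suc k ]    y (ℕ.s≤s ()) _ _
  small-units x (+ suc (suc k)) _ (ℕ.s≤s ()) _
  small-units x -[1+ suc k ]    _ (ℕ.s≤s ()) _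
  small-units (+ 0)    (+ 0)    _ _ ()
  small-units (+ 0)    (+ 1)    _ _ _ = 1 , refl
  small-units (+ 0)    -[1+ 0 ] _ _ _ = 4 , refl
  small-units (+ 1)    (+ 0)    _ _ _ = 0 , refl
  small-units (+ 1)    (+ 1)    _ _ ()
  small-units (+ 1)    -[1+ 0 ] _ _ _ = 5 , refl
  small-units -[1+ 0 ] (+ 0)    _ _ _ = 3 , refl
  small-units -[1+ 0 ] (+ 1)    _ _ _ = 2 , refl
  small-units -[1+ 0 ] -[1+ 0 ] _ _ ()

infix 4 _≟ᴱ_
_≟ᴱ_ : DecidableEquality EJInt
(a + b ρ) ≟ᴱ (c + d ρ) =
  map′ (uncurry ej≡) (λ e → cong re e , cong im e) (a ℤ.≟ c ×-dec b ℤ.≟ d)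

unit : Fin 6 → EJInt
unit j = ρ^ (toℕ j)

units-closed : ∀ i j → ∃ λ k → unit i ⊗ unit j ≡ unit k
units-closed = toWitness {a? = all? λ i → all? λ j → any? λ k → unit i ⊗ unit j ≟ᴱ unit k} _

units-inverse : ∀ i → ∃ λ k → unit i ⊗ unit k ≡ one
units-inverse = toWitness {a? = all? λ i → any? λ k → unit i ⊗ unit k ≟ᴱ one} _

-- Norms of differences of distinct units: 1 (neighbours), 3, or 4 (ζ - (-ζ) = 2ζ).
GapNorm : ℤ → Set
GapNorm t = t ≡ + 1 ⊎ t ≡ + 3 ⊎ t ≡ + 4

unit-gaps : ∀ i j → i ≡ j ⊎ GapNorm (N (unit i ⊖ unit j))
unit-gaps = toWitness {a? = all? λ i → all? λ j →
  i FinP.≟ j ⊎-dec N (unit i ⊖ unit j) ℤ.≟ + 1 ⊎-dec N (unit i ⊖ unit j) ℤ.≟ + 3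
             ⊎-dec N (unit i ⊖ unit j) ℤ.≟ + 4} _

-- Evaluation of x + yρ at an integer r.  For a root r of X² - X + 1 modulo n
-- this is a ring homomorphism ℤ[ρ] → ℤ/n sending ρ to r.

eval : ℤ → EJInt → ℤ
eval r (x + y ρ) = x + y * r

eval-⊕ : ∀ r a b → eval r (a ⊕ b) ≡ eval r a + eval r b
eval-⊕ r (x + y ρ) (u + v ρ) = regroup x y u v r
  where
  regroup : ∀ x y u v r → (x + u) + (y + v) * r ≡ (x + y * r) + (u + v * r)
  regroup = solve-∀

eval-⊖ : ∀ r a b → eval r (a ⊖ b) ≡ eval r a - eval r b
eval-⊖ r (x + y ρ) (u + v ρ) = regroup x y u v r
  where
  regroup : ∀ x y u v r → (x - u) + (y - v) * r ≡ (x + y * r) - (u + v * r)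
  regroup = solve-∀

eval-ι : ∀ r m → eval r (ι m) ≡ m
eval-ι r m = trans (cong (λ z → m + z) (ℤP.*-zeroˡ r)) (ℤP.+-identityʳ m)

eval-⊗ : ∀ r a b → eval r (a ⊗ b) ≡ eval r a * eval r b - im a * im b * (r * r - r + + 1)
eval-⊗ r (x + y ρ) (u + v ρ) = expand x y u v r
  where
  expand : ∀ x y u v r → (x * u - y * v) + (x * v + y * u + y * v) * r
                         ≡ (x + y * r) * (u + v * r) - y * v * (r * r - r + + 1)
  expand = solve-∀

-- The product (c + dρ)‾ (x + yρ), written through the values at r; it is the
-- key to computing the kernel of evaluation.
conj-⊗-eval : ∀ r c d x y → conj (c + d ρ) ⊗ (x + y ρ) ≡
  ((c + d) * eval r (x + y ρ) - y * r * eval r (c + d ρ) + y * d * (r * r - r + + 1)) +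
  (y * eval r (c + d ρ) - d * eval r (x + y ρ)) ρ
conj-⊗-eval r c d x y = ej≡ (real r c d x y) (imag r c d x y)
  where
  real : ∀ r c d x y → (c + d) * x - (- d) * y
                       ≡ (c + d) * (x + y * r) - y * r * (c + d * r) + y * d * (r * r - r + + 1)
  real = solve-∀
  imag : ∀ r c d x y → (c + d) * y + (- d) * x + (- d) * y ≡ y * (c + d * r) - d * (x + y * r)
  imag = solve-∀

-- Congruence modulo n in ℤ.  The relation is wrapped in a record so that
-- its endpoints can be inferred, which makes the reasoning chains below work.
module Congruence (n : ℕ) where

  infix 4 _≈_
  record _≈_ (x y : ℤ) : Set where
    constructor mk
    field proof : ModEq n x y
  open _≈_ public

  ≈-refl : ∀ {x} → x ≈ x
  ≈-refl {x} = mk (+ 0 , ℤP.+-inverseʳ x)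

  ≡⇒≈ : ∀ {x y} → x ≡ y → x ≈ y
  ≡⇒≈ refl = ≈-refl

  ≈-sym : ∀ {x y} → x ≈ y → y ≈ x
  ≈-sym {x} {y} (mk (q , e)) = mk (- q , (begin
    y - x        ≡⟨ solve (x ∷ y ∷ []) ⟩
    - (x - y)    ≡⟨ cong -_ e ⟩
    - (q * + n)  ≡⟨ ℤP.neg-distribˡ-* q (+ n) ⟩
    - q * + n    ∎))
    where open ≡-Reasoning

  ≈-trans : ∀ {x y z} → x ≈ y → y ≈ z → x ≈ z
  ≈-trans {x} {y} {z} (mk (q , e)) (mk (p , f)) = mk (q + p , (begin
    x - z                ≡⟨ solve (x ∷ y ∷ z ∷ []) ⟩
    (x - y) + (y - z)    ≡⟨ cong₂ _+_ e f ⟩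
    q * + n + p * + n    ≡⟨ sym (ℤP.*-distribʳ-+ (+ n) q p) ⟩
    (q + p) * + n        ∎))
    where open ≡-Reasoning

  ≈-+ : ∀ {x y u v} → x ≈ y → u ≈ v → x + u ≈ y + v
  ≈-+ {x} {y} {u} {v} (mk (q , e)) (mk (p , f)) = mk (q + p , (begin
    (x + u) - (y + v)    ≡⟨ solve (x ∷ y ∷ u ∷ v ∷ []) ⟩
    (x - y) + (u - v)    ≡⟨ cong₂ _+_ e f ⟩
    q * + n + p * + n    ≡⟨ sym (ℤP.*-distribʳ-+ (+ n) q p) ⟩
    (q + p) * + n        ∎))
    where open ≡-Reasoning

  ≈-neg : ∀ {x y} → x ≈ y → - x ≈ - y
  ≈-neg {x} {y} (mk (q , e)) = mk (- q , (begin
    - x - - y    ≡⟨ solve (x ∷ y ∷ []) ⟩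
    - (x - y)    ≡⟨ cong -_ e ⟩
    - (q * + n)  ≡⟨ ℤP.neg-distribˡ-* q (+ n) ⟩
    - q * + n    ∎))
    where open ≡-Reasoning

  ≈-- : ∀ {x y u v} → x ≈ y → u ≈ v → x - u ≈ y - v
  ≈-- x≈y u≈v = ≈-+ x≈y (≈-neg u≈v)

  ≈-* : ∀ {x y u v} → x ≈ y → u ≈ v → x * u ≈ y * v
  ≈-* {x} {y} {u} {v} (mk (q , e)) (mk (p , f)) = mk (q * u + y * p , (begin
    x * u - y * v                  ≡⟨ solve (x ∷ y ∷ u ∷ v ∷ []) ⟩
    (x - y) * u + y * (u - v)      ≡⟨ cong₂ (λ a b → a * u + y * b) e f ⟩
    (q * + n) * u + y * (p * + n)  ≡⟨ collect q p u y (+ n) ⟩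
    (q * u + y * p) * + n          ∎))
    where
    open ≡-Reasoning
    collect : ∀ q p u y m → (q * m) * u + y * (p * m) ≡ (q * u + y * p) * m
    collect = solve-∀

  ≈-*ˡ : ∀ a {u v} → u ≈ v → a * u ≈ a * v
  ≈-*ˡ a = ≈-* (≈-refl {a})

  ≈-cancel-+ˡ : ∀ x {a b} → x + a ≈ x + b → a ≈ b
  ≈-cancel-+ˡ x {a} {b} (mk (q , e)) = mk (q , trans (sym (shift x a b)) e)
    where
    shift : ∀ x a b → (x + a) - (x + b) ≡ a - b
    shift = solve-∀

  ≈⇒-≈0 : ∀ {x y} → x ≈ y → x - y ≈ + 0
  ≈⇒-≈0 {x} {y} (mk (q , e)) = mk (q , trans (ℤP.+-identityʳ (x - y)) e)

  -≈0⇒≈ : ∀ {x y} → x - y ≈ + 0 → x ≈ y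
  -≈0⇒≈ {x} {y} (mk (q , e)) = mk (q , trans (sym (ℤP.+-identityʳ (x - y))) e)

  module ≈-Reasoning where
    infixr 2 step-≈ step-≡
    infix 3 _∎
    step-≈ : ∀ x {y z} → y ≈ z → x ≈ y → x ≈ z
    step-≈ _ y≈z x≈y = ≈-trans x≈y y≈z
    syntax step-≈ x y≈z x≈y = x ≈⟨ x≈y ⟩ y≈z
    step-≡ : ∀ x {y z} → y ≈ z → x ≡ y → x ≈ z
    step-≡ _ y≈z x≡y = ≈-trans (≡⇒≈ x≡y) y≈z
    syntax step-≡ x y≈z x≡y = x ≡⟨ x≡y ⟩ y≈z
    _∎ : ∀ x → x ≈ x
    _ ∎ = ≈-refl

  multiple≈0 : ∀ q → q * + n ≈ + 0
  multiple≈0 q = mk (q , ℤP.+-identityʳ (q * + n))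

  Invertible : ℤ → Set
  Invertible x = ∃ λ y → x * y ≈ + 1

  1≉0 : 2 ℕ.≤ n → ¬ (+ 1 ≈ + 0)
  1≉0 2≤n (mk (q , e)) =
    ℕP.<⇒≢ 2≤n (sym (ℕP.m*n≡1⇒n≡1 ∣ q ∣ n (sym (trans (cong ∣_∣ e) (ℤP.abs-* q (+ n))))))

  invertible-cancel : ∀ {x y} → Invertible x → x * y ≈ + 0 → y ≈ + 0
  invertible-cancel {x} {y} (x⁻¹ , inv) xy≈0 =
    y                 ≡⟨ sym (ℤP.*-identityˡ y) ⟩
    + 1 * y           ≈⟨ ≈-* (≈-sym inv) ≈-refl ⟩
    (x * x⁻¹) * y     ≡⟨ solve (x ∷ x⁻¹ ∷ y ∷ []) ⟩
    x⁻¹ * (x * y)     ≈⟨ ≈-*ˡ x⁻¹ xy≈0 ⟩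
    x⁻¹ * + 0         ≡⟨ ℤP.*-zeroʳ x⁻¹ ⟩
    + 0               ∎
    where open ≈-Reasoning

  invertible≉0 : 2 ℕ.≤ n → ∀ {x} → Invertible x → ¬ (x ≈ + 0)
  invertible≉0 2≤n {x} inv x≈0 =
    1≉0 2≤n (invertible-cancel {x} {+ 1} inv (≈-trans (≡⇒≈ (ℤP.*-identityʳ x)) x≈0))

  invertible-resp : ∀ {x y} → x ≈ y → Invertible y → Invertible x
  invertible-resp x≈y (y⁻¹ , inv) = y⁻¹ , ≈-trans (≈-* x≈y ≈-refl) inv

  translation-fixed : ∀ h k x → h ≈ + 1 → h * x + k ≈ x → k ≈ + 0
  translation-fixed h k x h≈1 fixes =
    k                        ≡⟨ translation h k x ⟩
    (h * x + k) - h * x      ≈⟨ ≈-- fixes (≈-* h≈1 (≈-refl {x})) ⟩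
    x - + 1 * x              ≡⟨ cong (λ z → x - z) (ℤP.*-identityˡ x) ⟩
    x - x                    ≡⟨ ℤP.+-inverseʳ x ⟩
    + 0                      ∎
    where
    open ≈-Reasoning
    translation : ∀ h k x → k ≡ (h * x + k) - h * x
    translation = solve-∀

  fixed-point-unique : ∀ h k x y → Invertible (h - + 1) →
                       h * x + k ≈ x → h * y + k ≈ y → x ≈ y
  fixed-point-unique h k x y inv fixes-x fixes-y = -≈0⇒≈ (invertible-cancel {h - + 1} {x - y} inv (
    (h - + 1) * (x - y)                   ≡⟨ difference h k x y ⟩
    ((h * x + k) - x) - ((h * y + k) - y) ≈⟨ ≈-- (≈⇒-≈0 fixes-x) (≈⇒-≈0 fixes-y) ⟩
    + 0 - + 0                             ≡⟨ refl ⟩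
    + 0                                   ∎))
    where
    open ≈-Reasoning
    difference : ∀ h k x y → (h - + 1) * (x - y) ≡ ((h * x + k) - x) - ((h * y + k) - y)
    difference = solve-∀

-- Counting classes.

HasCard-pairs : {A : Set} {_≈_ : A → A → Set} {P : A → Set} {m k : ℕ}
  (f : Fin m → Fin k → A) →
  (∀ a b → P (f a b)) →
  (∀ a b a′ b′ → f a b ≈ f a′ b′ → a ≡ a′ × b ≡ b′) →
  (∀ x → P x → ∃ λ a → ∃ λ b → x ≈ f a b) →
  HasCard _≈_ P (m ℕ.* k)
HasCard-pairs {_≈_ = _≈_} {P} {m} {k} f inP inj cover =
  uncurry f ∘ remQuot {m} k , (λ i → uncurry inP (remQuot {m} k i)) , injective , covering
  where
  injective : ∀ i j → uncurry f (remQuot {m} k i) ≈ uncurry f (remQuot {m} k j) → i ≡ j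
  injective i j e with inj _ _ _ _ e
  ... | a≡ , b≡ = begin
    i                                ≡⟨ sym (FinP.combine-remQuot {m} k i) ⟩
    uncurry combine (remQuot {m} k i)  ≡⟨ cong (uncurry combine) (cong₂ _,_ a≡ b≡) ⟩
    uncurry combine (remQuot {m} k j)  ≡⟨ FinP.combine-remQuot {m} k j ⟩
    j                                ∎
    where open ≡-Reasoning
  covering : ∀ x → P x → ∃ λ i → x ≈ uncurry f (remQuot {m} k i)
  covering x Px with cover x Px
  ... | a , b , x≈ = combine a b , subst (λ ab → x ≈ uncurry f ab) (sym (FinP.remQuot-combine a b)) x≈

HasCard-image : {A B : Set} {_≈A_ : A → A → Set} {_≈B_ : B → B → Set} {Q : B → Set} {k : ℕ} →
  (∀ {x y z} → x ≈B y → y ≈B z → x ≈B z) →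
  (g : A → B) →
  (∀ {x y} → x ≈A y → g x ≈B g y) →
  (∀ {x y} → g x ≈B g y → x ≈A y) →
  (∀ x → Q (g x)) →
  (∀ z → Q z → ∃ λ x → z ≈B g x) →
  HasCard _≈A_ (λ _ → ⊤) k → HasCard _≈B_ Q k
HasCard-image {_≈B_ = _≈B_} {Q} ≈B-trans g g-cong g-reflect inQ onto (f , _ , inj , cover) =
  g ∘ f , (λ i → inQ (f i)) , (λ i j e → inj i j (g-reflect e)) , covering
  where
  covering : ∀ z → Q z → ∃ λ i → z ≈B g (f i)
  covering z Qz with onto z Qz
  ... | x , z≈gx with cover x tt
  ...   | i , x≈fi = i , ≈B-trans z≈gx (g-cong x≈fi)

HasCard-⇔ : {A : Set} {_≈_ : A → A → Set} {P Q : A → Set} {k : ℕ} →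
  (∀ x → P x → Q x) → (∀ x → Q x → P x) → HasCard _≈_ P k → HasCard _≈_ Q k
HasCard-⇔ P⇒Q Q⇒P (f , inP , inj , cover) =
  f , (λ i → P⇒Q (f i) (inP i)) , inj , (λ x Qx → cover x (Q⇒P x Qx))

multiple-bound : ∀ {ℓ a a′} K {k} → ∣ K ∣ ≡ suc k → + a - + a′ ≡ + ℓ * K → ℓ ℕ.≤ a ℕ.⊔ a′
multiple-bound {ℓ} {a} {a′} K {k} ∣K∣≡ e = begin
  ℓ                  ≤⟨ ℕP.m≤m*n ℓ (suc k) ⟩
  ℓ ℕ.* suc k        ≡⟨ cong (ℓ ℕ.*_) (sym ∣K∣≡) ⟩
  ℓ ℕ.* ∣ K ∣        ≡⟨ sym (ℤP.abs-* (+ ℓ) K) ⟩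
  ∣ + ℓ * K ∣        ≡⟨ cong ∣_∣ (sym e) ⟩
  ∣ + a - + a′ ∣     ≡⟨ cong ∣_∣ (ℤP.m-n≡m⊖n a a′) ⟩
  ∣ a ℤ.⊖ a′ ∣       ≤⟨ ℤP.∣m⊝n∣≤m⊔n a a′ ⟩
  a ℕ.⊔ a′           ∎
  where open ℕP.≤-Reasoning

below-congruent : ∀ {ℓ a a′} K → a ℕ.< ℓ → a′ ℕ.< ℓ → + a - + a′ ≡ + ℓ * K → a ≡ a′
below-congruent {ℓ} {a} {a′} (+ zero) _ _ e =
  ℤP.+-injective (ℤP.i-j≡0⇒i≡j (+ a) (+ a′) (trans e (ℤP.*-zeroʳ (+ ℓ))))
below-congruent {a = a} {a′} K@(+[1+ k ]) a<ℓ a′<ℓ e = ⊥-elim (ℕP.<⇒≱ (ℕP.⊔-lub a<ℓ a′<ℓ) (multiple-bound {a = a} {a′} K refl e))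
below-congruent {a = a} {a′} K@(-[1+ k ]) a<ℓ a′<ℓ e = ⊥-elim (ℕP.<⇒≱ (ℕP.⊔-lub a<ℓ a′<ℓ) (multiple-bound {a = a} {a′} K refl e))

-- ℤ[ρ]/(ℓ) has ℓ² elements, represented by the a + bρ with 0 ≤ a, b < ℓ.
residues : ∀ ℓ .{{_ : ℕ.NonZero ℓ}} → HasCard (ModEJ (ι (+ ℓ))) (λ _ → ⊤) (ℓ ℕ.^ 2)
residues ℓ = subst (HasCard (ModEJ (ι (+ ℓ))) (λ _ → ⊤)) (cong (ℓ ℕ.*_) (sym (ℕP.*-identityʳ ℓ)))
  (HasCard-pairs {_≈_ = ModEJ (ι (+ ℓ))} digits (λ _ _ → tt) injective covering)
  where
  digits : Fin ℓ → Fin ℓ → EJInt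
  digits a b = (+ toℕ a) + (+ toℕ b) ρ
  injective : ∀ a b a′ b′ → ModEJ (ι (+ ℓ)) (digits a b) (digits a′ b′) → a ≡ a′ × b ≡ b′
  injective a b a′ b′ (q , e) =
    FinP.toℕ-injective (below-congruent (re q) (FinP.toℕ<n a) (FinP.toℕ<n a′) (cong re e′)) ,
    FinP.toℕ-injective (below-congruent (im q) (FinP.toℕ<n b) (FinP.toℕ<n b′) (cong im e′))
    where e′ = trans e (⊗-ι q (+ ℓ))
  digit : ℤ → Fin ℓ
  digit x = fromℕ< (n%ℕd<d x ℓ)
  remainder : ∀ x → x - + toℕ (digit x) ≡ + ℓ * (x /ℕ ℓ)
  remainder x = begin
    x - + toℕ (digit x)                             ≡⟨ cong (λ a → x - + a) (FinP.toℕ-fromℕ< (n%ℕd<d x ℓ)) ⟩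
    x - + (x %ℕ ℓ)                                  ≡⟨ cong (_- + (x %ℕ ℓ)) (a≡a%ℕn+[a/ℕn]*n x ℓ) ⟩
    (+ (x %ℕ ℓ) + (x /ℕ ℓ) * + ℓ) - + (x %ℕ ℓ)      ≡⟨ drop (+ (x %ℕ ℓ)) (x /ℕ ℓ) (+ ℓ) ⟩
    + ℓ * (x /ℕ ℓ)                                  ∎
    where
    open ≡-Reasoning
    drop : ∀ a q m → (a + q * m) - a ≡ m * q
    drop = solve-∀
  covering : ∀ z → ⊤ → ∃ λ a → ∃ λ b → ModEJ (ι (+ ℓ)) z (digits a b)
  covering (x + y ρ) _ = digit x , digit y , (x /ℕ ℓ) + (y /ℕ ℓ) ρ ,
    trans (ej≡ (remainder x) (remainder y)) (sym (⊗-ι _ (+ ℓ)))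

abs-sign : ∀ z → ∃ λ σ → + ∣ z ∣ ≡ σ * z
abs-sign (+ k)    = + 1 , sym (ℤP.*-identityˡ (+ k))
abs-sign -[1+ k ] = - + 1 , cong (λ m → + suc m) (sym (ℕP.+-identityʳ k))

identity-in-ℤ : ∀ {g a b x y} → g ℕ.+ y ℕ.* b ≡ x ℕ.* a → + x * + a - + y * + b ≡ + g
identity-in-ℤ {g} {a} {b} {x} {y} eq = begin
  + x * + a - + y * + b              ≡⟨ cong (_- + y * + b) (sym (ℤP.pos-* x a)) ⟩
  + (x ℕ.* a) - + y * + b            ≡⟨ cong (λ m → + m - + y * + b) (sym eq) ⟩
  + (g ℕ.+ y ℕ.* b) - + y * + b      ≡⟨ cong (λ m → m - + y * + b) (ℤP.pos-+ g (y ℕ.* b)) ⟩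
  + g + + (y ℕ.* b) - + y * + b      ≡⟨ cong (λ m → + g + m - + y * + b) (ℤP.pos-* y b) ⟩
  + g + + y * + b - + y * + b        ≡⟨ cancel (+ g) (+ y * + b) ⟩
  + g                                ∎
  where
  open ≡-Reasoning
  cancel : ∀ g m → g + m - m ≡ g
  cancel = solve-∀

bezout : ∀ c d → ∃ λ x → ∃ λ y → x * c + y * d ≡ + gcd ∣ c ∣ ∣ d ∣
bezout c d with Bézout.identity (gcd-GCD ∣ c ∣ ∣ d ∣) | abs-sign c | abs-sign d
... | Bézout.+- x y eq | σ , ∣c∣≡ | τ , ∣d∣≡ = + x * σ , - (+ y * τ) , (begin
  + x * σ * c + - (+ y * τ) * d        ≡⟨ regroup (+ x) σ c (+ y) τ d ⟩
  + x * (σ * c) - + y * (τ * d)        ≡⟨ cong₂ (λ u v → + x * u - + y * v) (sym ∣c∣≡) (sym ∣d∣≡) ⟩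
  + x * (+ ∣ c ∣) - + y * (+ ∣ d ∣)    ≡⟨ identity-in-ℤ {a = ∣ c ∣} {∣ d ∣} {x} {y} eq ⟩
  + gcd ∣ c ∣ ∣ d ∣                    ∎)
  where
  open ≡-Reasoning
  regroup : ∀ x σ c y τ d → x * σ * c + - (y * τ) * d ≡ x * (σ * c) - y * (τ * d)
  regroup = solve-∀
... | Bézout.-+ x y eq | σ , ∣c∣≡ | τ , ∣d∣≡ = - (+ x * σ) , + y * τ , (begin
  - (+ x * σ) * c + + y * τ * d        ≡⟨ regroup (+ x) σ c (+ y) τ d ⟩
  + y * (τ * d) - + x * (σ * c)        ≡⟨ cong₂ (λ v u → + y * v - + x * u) (sym ∣d∣≡) (sym ∣c∣≡) ⟩
  + y * (+ ∣ d ∣) - + x * (+ ∣ c ∣)    ≡⟨ identity-in-ℤ {a = ∣ d ∣} {∣ c ∣} {y} {x} eq ⟩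
  + gcd ∣ c ∣ ∣ d ∣                    ∎)
  where
  open ≡-Reasoning
  regroup : ∀ x σ c y τ d → - (x * σ) * c + y * τ * d ≡ y * (τ * d) - x * (σ * c)
  regroup = solve-∀

coprime-parts : ∀ {c d c′ d′} .{{_ : ℕ.NonZero (gcd ∣ c ∣ ∣ d ∣)}} →
  c ≡ + gcd ∣ c ∣ ∣ d ∣ * c′ → d ≡ + gcd ∣ c ∣ ∣ d ∣ * d′ →
  ∃ λ s → ∃ λ t → s * c′ + t * d′ ≡ + 1
coprime-parts {c} {d} {c′} {d′} hc hd with bezout c d
... | s , t , eq = s , t , ℤP.*-cancelˡ-≡ (+ ℓ) (s * c′ + t * d′) (+ 1) (begin
  + ℓ * (s * c′ + t * d′)           ≡⟨ distribute (+ ℓ) s c′ t d′ ⟩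
  s * (+ ℓ * c′) + t * (+ ℓ * d′)   ≡⟨ cong₂ (λ u v → s * u + t * v) (sym hc) (sym hd) ⟩
  s * c + t * d                     ≡⟨ eq ⟩
  + ℓ                               ≡⟨ sym (ℤP.*-identityʳ (+ ℓ)) ⟩
  + ℓ * + 1                         ∎)
  where
  open ≡-Reasoning
  ℓ = gcd ∣ c ∣ ∣ d ∣
  distribute : ∀ l s c t d → l * (s * c + t * d) ≡ s * (l * c) + t * (l * d)
  distribute = solve-∀

-- Then r = 1 - t(c′ + d′) + s d′ is a common
-- root of c′ + d′X and X² - X + 1 modulo n, and φ = evaluation at r identifies
-- ℤ[ρ]/(α′) with ℤ/n, carrying the six units to the subgroup H of the
-- Frobenius group.
module Reduction (c′ d′ s t : ℤ) (s-t-bezout : s * c′ + t * d′ ≡ + 1) (n₀ : ℕ)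
                 (normα′ : N (c′ + d′ ρ) ≡ + (2 ℕ.+ n₀))
                 (six-invertible : Congruence.Invertible (2 ℕ.+ n₀) (+ 6)) where

  n : ℕ
  n = 2 ℕ.+ n₀

  open Congruence n

  α′ : EJInt
  α′ = c′ + d′ ρ

  r : ℤ
  r = + 1 - t * (c′ + d′) + s * d′

  r-root-α′ : c′ + d′ * r ≡ s * + n
  r-root-α′ = begin
    c′ + d′ * (+ 1 - t * (c′ + d′) + s * d′)
      ≡⟨ expand c′ d′ s t ⟩
    s * (c′ * c′ + c′ * d′ + d′ * d′) + (c′ + d′) * (+ 1 - (s * c′ + t * d′))
      ≡⟨ cong₂ (λ m b → s * m + (c′ + d′) * (+ 1 - b)) normα′ s-t-bezout ⟩
    s * + n + (c′ + d′) * (+ 1 - + 1)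
      ≡⟨ vanish (s * + n) (c′ + d′) ⟩
    s * + n ∎
    where
    open ≡-Reasoning
    expand : ∀ c d s t → c + d * (+ 1 - t * (c + d) + s * d)
                         ≡ s * (c * c + c * d + d * d) + (c + d) * (+ 1 - (s * c + t * d))
    expand = solve-∀
    vanish : ∀ a b → a + b * (+ 1 - + 1) ≡ a
    vanish = solve-∀

  r-root-ρ : r * r - r + + 1 ≡ (s * s - s * t + t * t) * + n
  r-root-ρ = begin
    r * r - r + + 1
      ≡⟨ expand c′ d′ s t ⟩
    (s * s - s * t + t * t) * (c′ * c′ + c′ * d′ + d′ * d′)
      + (s * c′ + t * d′ - + 1) * (t * (c′ + d′) - s * d′ - + 1 - (s * c′ + t * d′))
      ≡⟨ cong₂ (λ m b → (s * s - s * t + t * t) * m + (b - + 1) * (t * (c′ + d′) - s * d′ - + 1 - b))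
               normα′ s-t-bezout ⟩
    (s * s - s * t + t * t) * + n + (+ 1 - + 1) * (t * (c′ + d′) - s * d′ - + 1 - + 1)
      ≡⟨ vanish ((s * s - s * t + t * t) * + n) (t * (c′ + d′) - s * d′ - + 1 - + 1) ⟩
    (s * s - s * t + t * t) * + n ∎
    where
    open ≡-Reasoning
    expand : ∀ c d s t →
      (+ 1 - t * (c + d) + s * d) * (+ 1 - t * (c + d) + s * d) - (+ 1 - t * (c + d) + s * d) + + 1
      ≡ (s * s - s * t + t * t) * (c * c + c * d + d * d)
        + (s * c + t * d - + 1) * (t * (c + d) - s * d - + 1 - (s * c + t * d))
    expand = solve-∀
    vanish : ∀ a b → a + (+ 1 - + 1) * b ≡ a
    vanish = solve-∀

  φ : EJInt → ℤ
  φ = eval r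

  φ-⊗ : ∀ a b → φ (a ⊗ b) ≈ φ a * φ b
  φ-⊗ a b =
    φ (a ⊗ b)                                            ≡⟨ eval-⊗ r a b ⟩
    φ a * φ b - im a * im b * (r * r - r + + 1)          ≡⟨ cong (λ m → φ a * φ b - im a * im b * m) r-root-ρ ⟩
    φ a * φ b - im a * im b * ((s * s - s * t + t * t) * + n)
      ≈⟨ ≈-- (≈-refl {φ a * φ b}) (≈-*ˡ (im a * im b) (multiple≈0 (s * s - s * t + t * t))) ⟩
    φ a * φ b - im a * im b * + 0                        ≡⟨ drop (φ a * φ b) (im a * im b) ⟩
    φ a * φ b                                            ∎
    where
    open ≈-Reasoning
    drop : ∀ x m → x - m * + 0 ≡ x
    drop = solve-∀

  φ-α′ : φ α′ ≈ + 0
  φ-α′ = ≈-trans (≡⇒≈ r-root-α′) (multiple≈0 s)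

  φ-multiple : ∀ q → φ (α′ ⊗ q) ≈ + 0
  φ-multiple q =
    φ (α′ ⊗ q)       ≈⟨ φ-⊗ α′ q ⟩
    φ α′ * φ q       ≈⟨ ≈-* φ-α′ (≈-refl {φ q}) ⟩
    + 0 * φ q        ≡⟨ ℤP.*-zeroˡ (φ q) ⟩
    + 0              ∎
    where open ≈-Reasoning

  φ-respects : ∀ γ → φ γ ≈ + 0 → ∀ a b → ModEJ γ a b → φ a ≈ φ b
  φ-respects γ φγ≈0 a b (q , e) = -≈0⇒≈ (
    φ a - φ b        ≡⟨ sym (eval-⊖ r a b) ⟩
    φ (a ⊖ b)        ≡⟨ cong φ e ⟩
    φ (q ⊗ γ)        ≈⟨ φ-⊗ q γ ⟩
    φ q * φ γ        ≈⟨ ≈-*ˡ (φ q) φγ≈0 ⟩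
    φ q * + 0        ≡⟨ ℤP.*-zeroʳ (φ q) ⟩
    + 0              ∎)
    where open ≈-Reasoning

  -- (Passed explicitly: instance search would try to normalise the norm.)
  conj-α′-nonzero : ℤ.NonZero (N (conj α′))
  conj-α′-nonzero = subst ℤ.NonZero (sym (trans (N-conj α′) normα′)) _

  -- The kernel of φ is the ideal (α′): multiply by ᾱ′ and compare coordinates.
  kernel : ∀ z → φ z ≈ + 0 → ∃ λ q → z ≡ α′ ⊗ q
  kernel (x + y ρ) (mk (K , φz≡)) = q , ⊗-cancelˡ (conj α′) {{conj-α′-nonzero}} (begin
    conj α′ ⊗ (x + y ρ)
      ≡⟨ conj-⊗-eval r c′ d′ x y ⟩
    ((c′ + d′) * φ (x + y ρ) - y * r * φ α′ + y * d′ * (r * r - r + + 1)) + (y * φ α′ - d′ * φ (x + y ρ)) ρ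
      ≡⟨ cong₂ (λ P B → ((c′ + d′) * P - y * r * B + y * d′ * (r * r - r + + 1)) + (y * B - d′ * P) ρ)
               φz r-root-α′ ⟩
    ((c′ + d′) * (K * + n) - y * r * (s * + n) + y * d′ * (r * r - r + + 1)) + (y * (s * + n) - d′ * (K * + n)) ρ
      ≡⟨ cong (λ R → ((c′ + d′) * (K * + n) - y * r * (s * + n) + y * d′ * R) + (y * (s * + n) - d′ * (K * + n)) ρ)
              r-root-ρ ⟩
    ((c′ + d′) * (K * + n) - y * r * (s * + n) + y * d′ * (A * + n)) + (y * (s * + n) - d′ * (K * + n)) ρ
      ≡⟨ ej≡ (factor₁ (c′ + d′) K y r s d′ A (+ n)) (factor₂ y s d′ K (+ n)) ⟩
    + n · q
      ≡⟨ cong (_· q) (sym normα′) ⟩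
    N α′ · q
      ≡⟨ sym (conj-⊗ α′ q) ⟩
    conj α′ ⊗ (α′ ⊗ q) ∎)
    where
    open ≡-Reasoning
    A : ℤ
    A = s * s - s * t + t * t
    q : EJInt
    q = ((c′ + d′) * K - y * r * s + y * d′ * A) + (y * s - d′ * K) ρ
    φz : φ (x + y ρ) ≡ K * + n
    φz = trans (sym (ℤP.+-identityʳ (φ (x + y ρ)))) φz≡
    factor₁ : ∀ e K y r s d A m → e * (K * m) - y * r * (s * m) + y * d * (A * m) ≡ m * (e * K - y * r * s + y * d * A)
    factor₁ = solve-∀
    factor₂ : ∀ y s d K m → y * (s * m) - d * (K * m) ≡ m * (y * s - d * K)
    factor₂ = solve-∀

  reflect : ∀ a b → φ a ≈ φ b → ModEJ α′ a b
  reflect a b φa≈φb = q , trans a⊖b≡ (⊗-comm α′ q)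
    where
    a⊖b-in-kernel : φ (a ⊖ b) ≈ + 0
    a⊖b-in-kernel = ≈-trans (≡⇒≈ (eval-⊖ r a b)) (≈⇒-≈0 φa≈φb)
    q : EJInt
    q = proj₁ (kernel (a ⊖ b) a⊖b-in-kernel)
    a⊖b≡ : a ⊖ b ≡ α′ ⊗ q
    a⊖b≡ = proj₂ (kernel (a ⊖ b) a⊖b-in-kernel)

  u : Fin 6 → ℤ
  u j = φ (unit j)

  u-zero : u zero ≡ + 1
  u-zero = eval-ι r (+ 1)

  u-⊕ : ∀ x j → φ (x ⊕ unit j) ≡ φ x + u j
  u-⊕ x j = eval-⊕ r x (unit j)

  -- Every integer of norm 1, 3 or 4 is a unit modulo n, since 6 is.
  six⁻¹ : ℤ
  six⁻¹ = proj₁ six-invertible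

  six-inverse : + 6 * six⁻¹ ≈ + 1
  six-inverse = proj₂ six-invertible

  gap-invertible : ∀ {g} → GapNorm g → Invertible g
  gap-invertible (inj₁ refl)        = + 1 , ≈-refl
  gap-invertible (inj₂ (inj₁ refl)) = + 2 * six⁻¹ , ≈-trans (≡⇒≈ (regroup six⁻¹)) six-inverse
    where
    regroup : ∀ w → + 3 * (+ 2 * w) ≡ + 6 * w
    regroup = solve-∀
  gap-invertible (inj₂ (inj₂ refl)) = + 9 * six⁻¹ * six⁻¹ , ≈-trans (≡⇒≈ (regroup six⁻¹)) (≈-* six-inverse six-inverse)
    where
    regroup : ∀ w → + 4 * (+ 9 * w * w) ≡ (+ 6 * w) * (+ 6 * w)
    regroup = solve-∀

  -- If N(a) is a unit modulo n then so is φ(a), with inverse φ(ā)/N(a).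
  φ-invertible : ∀ a → Invertible (N a) → Invertible (φ a)
  φ-invertible a (m , Na·m≈1) = φ (conj a) * m , (
    φ a * (φ (conj a) * m)    ≡⟨ regroup (φ a) (φ (conj a)) m ⟩
    (φ (conj a) * φ a) * m    ≈⟨ ≈-* (≈-sym (φ-⊗ (conj a) a)) (≈-refl {m}) ⟩
    φ (conj a ⊗ a) * m        ≡⟨ cong (λ z → φ z * m) (conj-norm a) ⟩
    φ (ι (N a)) * m           ≡⟨ cong (_* m) (eval-ι r (N a)) ⟩
    N a * m                   ≈⟨ Na·m≈1 ⟩
    + 1                       ∎)
    where
    open ≈-Reasoning
    regroup : ∀ x y m → x * (y * m) ≡ (y * x) * m
    regroup = solve-∀

  unit-gap-invertible : ∀ i j → i ≡ j ⊎ Invertible (u i - u j)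
  unit-gap-invertible i j = Sum.map₂ gap⇒invertible (unit-gaps i j)
    where
    gap⇒invertible : GapNorm (N (unit i ⊖ unit j)) → Invertible (u i - u j)
    gap⇒invertible gap = subst Invertible (eval-⊖ r (unit i) (unit j))
                           (φ-invertible (unit i ⊖ unit j) (gap-invertible gap))

  u-injective : ∀ i j → u i ≈ u j → i ≡ j
  u-injective i j ui≈uj = Sum.[ id , (λ inv → ⊥-elim (invertible≉0 (ℕ.s≤s (ℕ.s≤s ℕ.z≤n)) inv (≈⇒-≈0 ui≈uj))) ]′
                              (unit-gap-invertible i j)

  H : ℤ → Set
  H h = ∃ λ j → h ≈ u j

  H-resp : ∀ {h h′} → ModEq n h h′ → H h → H h′
  H-resp {h} {h′} h≈h′ (j , h≈uj) = j , ≈-trans (≈-sym (mk {h} {h′} h≈h′)) h≈uj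

  H-one : H (+ 1)
  H-one = zero , ≡⇒≈ (sym u-zero)

  H-mul : ∀ {h h′} → H h → H h′ → H (h * h′)
  H-mul {h} {h′} (i , h≈ui) (j , h′≈uj) = k ,
    (h * h′                 ≈⟨ ≈-* h≈ui h′≈uj ⟩
     u i * u j              ≈⟨ ≈-sym (φ-⊗ (unit i) (unit j)) ⟩
     φ (unit i ⊗ unit j)    ≡⟨ cong φ uiuj≡uk ⟩
     u k                    ∎)
    where
    open ≈-Reasoning
    k : Fin 6
    k = proj₁ (units-closed i j)
    uiuj≡uk : unit i ⊗ unit j ≡ unit k
    uiuj≡uk = proj₂ (units-closed i j)

  H-unit : ∀ {h} → H h → ∃ λ h′ → H h′ × ModEq n (h * h′) (+ 1)
  H-unit {h} (i , h≈ui) = u k , (k , ≈-refl) , proof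
    (h * u k                ≈⟨ ≈-* h≈ui (≈-refl {u k}) ⟩
     u i * u k              ≈⟨ ≈-sym (φ-⊗ (unit i) (unit k)) ⟩
     φ (unit i ⊗ unit k)    ≡⟨ cong φ uiuk≡1 ⟩
     φ one                  ≡⟨ u-zero ⟩
     + 1                    ∎)
    where
    open ≈-Reasoning
    k : Fin 6
    k = proj₁ (units-inverse i)
    uiuk≡1 : unit i ⊗ unit k ≡ one
    uiuk≡1 = proj₂ (units-inverse i)

  -- H acts fixed-point-freely: for h ∈ H with h ≠ 1, h - 1 is invertible.
  H-frobenius : ∀ h k x y → H h → ¬ ModEq n x y →
                ModEq n (h * x + k) x → ModEq n (h * y + k) y →
                ModEq n h (+ 1) × ModEq n k (+ 0)
  H-frobenius h k x y (j , h≈uj) x≉y fixes-x fixes-y =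
    Sum.[ identity , moving ]′ (unit-gap-invertible j zero)
    where
    fixes-x′ : h * x + k ≈ x
    fixes-x′ = mk {h * x + k} {x} fixes-x
    fixes-y′ : h * y + k ≈ y
    fixes-y′ = mk {h * y + k} {y} fixes-y
    identity : j ≡ zero → ModEq n h (+ 1) × ModEq n k (+ 0)
    identity j≡0 = proof h≈1 , proof (translation-fixed h k x h≈1 fixes-x′)
      where
      h≈1 : h ≈ + 1
      h≈1 = ≈-trans h≈uj (≡⇒≈ (trans (cong u j≡0) u-zero))
    moving : Invertible (u j - u zero) → ModEq n h (+ 1) × ModEq n k (+ 0)
    moving inv = ⊥-elim (x≉y (proof (fixed-point-unique h k x y h-1-invertible fixes-x′ fixes-y′)))
      where
      h-1-invertible : Invertible (h - + 1)
      h-1-invertible = invertible-resp (≈-- h≈uj (≡⇒≈ (sym u-zero))) inv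

  frobenius : IsFrobeniusCyclic n H
  frobenius = record
    { n-pos  = ℕ.s≤s ℕ.z≤n
    ; H-resp = λ {h} {h′} → H-resp {h} {h′}
    ; H-one  = H-one
    ; H-mul  = λ {h} {h′} → H-mul {h} {h′}
    ; H-unit = λ {h} → H-unit {h}
    ; nonreg = u (suc zero) , (suc zero , ≈-refl) , u₁≉1
    ; frob   = H-frobenius
    }
    where
    u₁≉1 : ¬ ModEq n (u (suc zero)) (+ 1)
    u₁≉1 u₁≈1 = 1≢0 (u-injective (suc zero) zero (≈-trans (mk {u (suc zero)} {+ 1} u₁≈1) (≡⇒≈ (sym u-zero))))
      where
      1≢0 : suc zero ≢ zero {5}
      1≢0 ()

  Orbit₁ : ℤ → Set
  Orbit₁ = Orbit n H (+ 1)

  orbit⇒H : ∀ x → Orbit₁ x → H x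
  orbit⇒H x (h , (j , h≈uj) , x≈h·1) =
    j , ≈-trans (mk {x} {h * + 1} x≈h·1) (≈-trans (≡⇒≈ (ℤP.*-identityʳ h)) h≈uj)

  H⇒orbit : ∀ x → H x → Orbit₁ x
  H⇒orbit x Hx = x , Hx , proof (≡⇒≈ (sym (ℤP.*-identityʳ x)))

  unit-orbit : ∀ j → Orbit₁ (u j)
  unit-orbit j = H⇒orbit (u j) (j , ≈-refl)

  H-card : HasCard (ModEq n) H 6
  H-card = u , (λ j → j , ≈-refl) , (λ i j ui≈uj → u-injective i j (mk {u i} {u j} ui≈uj)) ,
           (λ { x (j , x≈uj) → j , proof x≈uj })

  -- 1 ∈ 1^H, so the connection set generates ℤ/n.
  generated : ∀ x → Generated n Orbit₁ x
  generated (+ zero)     = gen-0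
  generated (+ suc m)    = gen-mod (gen-add {s = u zero} (generated (+ m)) (unit-orbit zero))
                             (proof (≡⇒≈ (trans (cong (λ z → + m + z) u-zero) (trans (sym (ℤP.pos-+ m 1)) (cong +_ (ℕP.+-comm m 1))))))
  generated -[1+ zero ]  = gen-mod (gen-sub {s = u zero} gen-0 (unit-orbit zero)) (proof (≡⇒≈ (cong (λ z → + 0 - z) u-zero)))
  generated -[1+ suc m ] = gen-mod (gen-sub {s = u zero} (generated -[1+ m ]) (unit-orbit zero))
                             (proof (≡⇒≈ (trans (cong (λ z → -[1+ m ] - z) u-zero) (cong (λ i → -[1+ suc i ]) (ℕP.+-identityʳ m)))))

  first-kind : FirstKindFrobCirc6 n H (+ 1)
  first-kind = record
    { frobenius = frobenius
    ; generates = generated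
    ; kind      = inj₁ (3 , H-card)
    ; six       = HasCard-⇔ {_≈_ = ModEq n} H⇒orbit orbit⇒H H-card
    }

  edge-image : ∀ γ → φ γ ≈ + 0 → ∀ x y → Graph.E (EJ γ) x y → Graph.E (Cay n Orbit₁) (φ x) (φ y)
  edge-image γ φγ≈0 x y (j , y≡x+uj) =
    u j , unit-orbit j , proof (≈-trans (φ-respects γ φγ≈0 y (x ⊕ unit j) y≡x+uj) (≡⇒≈ (u-⊕ x j)))

  iso : Iso (Cay n Orbit₁) (EJ α′)
  iso = record
    { f      = ι
    ; g      = φ
    ; f-cong = λ {x} {y} x≈y → reflect (ι x) (ι y)
                 (≈-trans (≡⇒≈ (eval-ι r x)) (≈-trans (mk {x} {y} x≈y) (≡⇒≈ (sym (eval-ι r y)))))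
    ; g-cong = λ {a} {b} a≡b → proof (φ-respects α′ φ-α′ a b a≡b)
    ; fg     = λ z → reflect (ι (φ z)) z (≡⇒≈ (eval-ι r (φ z)))
    ; gf     = λ x → proof (≡⇒≈ (eval-ι r x))
    ; f-E    = ι-edge
    ; g-E    = edge-image α′ φ-α′
    }
    where
    ι-edge : ∀ x y → Graph.E (Cay n Orbit₁) x y → Graph.E (EJ α′) (ι x) (ι y)
    ι-edge x y (s′ , os , y≈x+s′) = j , reflect (ι y) (ι x ⊕ unit j)
      (φ (ι y)                ≡⟨ eval-ι r y ⟩
       y                      ≈⟨ mk {y} {x + s′} y≈x+s′ ⟩
       x + s′                 ≈⟨ ≈-+ (≈-refl {x}) s′≈uj ⟩
       x + u j                ≡⟨ cong (_+ u j) (sym (eval-ι r x)) ⟩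
       φ (ι x) + u j          ≡⟨ sym (u-⊕ (ι x) j) ⟩
       φ (ι x ⊕ unit j)       ∎)
      where
      open ≈-Reasoning
      j : Fin 6
      j = proj₁ (orbit⇒H s′ os)
      s′≈uj : s′ ≈ u j
      s′≈uj = proj₂ (orbit⇒H s′ os)

  module Covering (ℓ : ℕ) .{{_ : ℕ.NonZero ℓ}} where

    α : EJInt
    α = α′ ⊗ ι (+ ℓ)

    φ-α : φ α ≈ + 0
    φ-α = φ-multiple (ι (+ ℓ))

    α′-nonzero : ℤ.NonZero (N α′)
    α′-nonzero = subst ℤ.NonZero (sym normα′) _

    -- The fibre of φ over v consists of the lifts v + α′q; two lifts agree
    -- modulo α exactly when the q agree modulo ℓ.
    lift : ℤ → EJInt → EJInt
    lift v q = ι v ⊕ α′ ⊗ q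

    lift-fibre : ∀ v q → φ (lift v q) ≈ v
    lift-fibre v q =
      φ (lift v q)             ≡⟨ eval-⊕ r (ι v) (α′ ⊗ q) ⟩
      φ (ι v) + φ (α′ ⊗ q)     ≈⟨ ≈-+ (≡⇒≈ (eval-ι r v)) (φ-multiple q) ⟩
      v + + 0                  ≡⟨ ℤP.+-identityʳ v ⟩
      v                        ∎
      where open ≈-Reasoning

    lift-cong : ∀ v {q q′} → ModEJ (ι (+ ℓ)) q q′ → ModEJ α (lift v q) (lift v q′)
    lift-cong v {q} {q′} (Q , q⊖q′≡) = Q , (begin
      lift v q ⊖ lift v q′      ≡⟨ translate-⊖ (ι v) α′ q q′ ⟩
      α′ ⊗ (q ⊖ q′)             ≡⟨ cong (α′ ⊗_) q⊖q′≡ ⟩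
      α′ ⊗ (Q ⊗ ι (+ ℓ))        ≡⟨ sym (⊗-rotate Q α′ (ι (+ ℓ))) ⟩
      Q ⊗ α                     ∎)
      where open ≡-Reasoning

    lift-reflect : ∀ v {q q′} → ModEJ α (lift v q) (lift v q′) → ModEJ (ι (+ ℓ)) q q′
    lift-reflect v {q} {q′} (Q , lift⊖lift≡) = Q , ⊗-cancelˡ α′ {{α′-nonzero}} (begin
      α′ ⊗ (q ⊖ q′)             ≡⟨ sym (translate-⊖ (ι v) α′ q q′) ⟩
      lift v q ⊖ lift v q′      ≡⟨ lift⊖lift≡ ⟩
      Q ⊗ α                     ≡⟨ ⊗-rotate Q α′ (ι (+ ℓ)) ⟩
      α′ ⊗ (Q ⊗ ι (+ ℓ))        ∎)
      where open ≡-Reasoning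

    -- Every z over v is a lift: z - v lies in the kernel (α′).
    lift-onto : ∀ v z → ModEq n (φ z) v → ∃ λ q → ModEJ α z (lift v q)
    lift-onto v z φz≈v = q , subst (ModEJ α z) z≡lift (ModEJ-refl α z)
      where
      z-v-in-kernel : φ (z ⊖ ι v) ≈ + 0
      z-v-in-kernel = ≈-trans (≡⇒≈ (trans (eval-⊖ r z (ι v)) (cong (λ m → φ z - m) (eval-ι r v))))
                              (≈⇒-≈0 (mk {φ z} {v} φz≈v))
      q : EJInt
      q = proj₁ (kernel (z ⊖ ι v) z-v-in-kernel)
      z≡lift : z ≡ lift v q
      z≡lift = trans (sym (⊕-⊖-cancel (ι v) z)) (cong (ι v ⊕_) (proj₂ (kernel (z ⊖ ι v) z-v-in-kernel)))

    fibre-card : ∀ v → HasCard (ModEJ α) (λ z → ModEq n (φ z) v) (ℓ ℕ.^ 2)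
    fibre-card v = HasCard-image (λ {x} {y} {z} → ModEJ-trans α {x} {y} {z}) (lift v)
                     (λ {q} {q′} → lift-cong v {q} {q′}) (λ {q} {q′} → lift-reflect v {q} {q′})
                     (λ q → proof (lift-fibre v q)) (lift-onto v) (residues ℓ)

    neighbour-injective : ∀ x w w′ → Graph.E (EJ α) x w → Graph.E (EJ α) x w′ →
                          ModEq n (φ w) (φ w′) → ModEJ α w w′
    neighbour-injective x w w′ (i , w≡x+ui) (j , w′≡x+uj) φw≈φw′ =
      ModEJ-trans α {w} {x ⊕ unit j} {w′} (subst (λ k → ModEJ α w (x ⊕ unit k)) i≡j w≡x+ui)
                                          (ModEJ-sym α {w′} {x ⊕ unit j} w′≡x+uj)
      where
      open ≈-Reasoning
      i≡j : i ≡ j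
      i≡j = u-injective i j (≈-cancel-+ˡ (φ x)
        (φ x + u i              ≡⟨ sym (u-⊕ x i) ⟩
         φ (x ⊕ unit i)         ≈⟨ ≈-sym (φ-respects α φ-α w (x ⊕ unit i) w≡x+ui) ⟩
         φ w                    ≈⟨ mk {φ w} {φ w′} φw≈φw′ ⟩
         φ w′                   ≈⟨ φ-respects α φ-α w′ (x ⊕ unit j) w′≡x+uj ⟩
         φ (x ⊕ unit j)         ≡⟨ u-⊕ x j ⟩
         φ x + u j              ∎))

    neighbour-onto : ∀ x z → Graph.E (Cay n Orbit₁) (φ x) z →
                     ∃ λ w → Graph.E (EJ α) x w × ModEq n (φ w) z
    neighbour-onto x z (s′ , os , z≈φx+s′) = x ⊕ unit j , (j , ModEJ-refl α (x ⊕ unit j)) , proof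
      (φ (x ⊕ unit j)      ≡⟨ u-⊕ x j ⟩
       φ x + u j           ≈⟨ ≈-+ (≈-refl {φ x}) (≈-sym s′≈uj) ⟩
       φ x + s′            ≈⟨ ≈-sym (mk {z} {φ x + s′} z≈φx+s′) ⟩
       z                   ∎)
      where
      open ≈-Reasoning
      j : Fin 6
      j = proj₁ (orbit⇒H s′ os)
      s′≈uj : s′ ≈ u j
      s′≈uj = proj₂ (orbit⇒H s′ os)

    covering : Cover (ℓ ℕ.^ 2) (EJ α) (Cay n Orbit₁)
    covering = record
      { φ       = φ
      ; φ-cong  = λ {a} {b} a≡b → proof (φ-respects α φ-α a b a≡b)
      ; nb-map  = edge-image α φ-α
      ; nb-inj  = neighbour-injective
      ; nb-surj = neighbour-onto
      ; fibres  = fibre-card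
      }

N-⊗-ι : ∀ a m → N (a ⊗ ι m) ≡ (m * m) * N a
N-⊗-ι (x + y ρ) m = norm x y m
  where
  norm : ∀ x y m → (x * m - y * + 0) * (x * m - y * + 0) + (x * m - y * + 0) * (x * + 0 + y * m + y * + 0)
                   + (x * + 0 + y * m + y * + 0) * (x * + 0 + y * m + y * + 0) ≡ (m * m) * (x * x + x * y + y * y)
  norm = solve-∀

factorisation : ∀ {c d c′ d′} ℓ → c ≡ + ℓ * c′ → d ≡ + ℓ * d′ → (c + d ρ) ≡ (c′ + d′ ρ) ⊗ ι (+ ℓ)
factorisation {c′ = c′} {d′} ℓ hc hd = trans (ej≡ hc hd) (sym (⊗-ι (c′ + d′ ρ) (+ ℓ)))

norm-factor : ∀ {α α′} ℓ → α ≡ α′ ⊗ ι (+ ℓ) → N α ≡ (+ ℓ * + ℓ) * N α′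
norm-factor {α′ = α′} ℓ refl = N-⊗-ι α′ (+ ℓ)

scale-nonzero : ∀ ℓ x → + 7 ≤ (+ ℓ * + ℓ) * x → ℕ.NonZero ℓ
scale-nonzero zero    x (ℤ.+≤+ ())
scale-nonzero (suc ℓ) x _ = _

-- N(α′) is at least 2: N(α′) = 0 contradicts N(α) ≥ 7, and N(α′) = 1 makes
-- α′ a unit, so that α = α′ℓ would be an associate of the integer ℓ.
norm-at-least-2 : ∀ {c d c′ d′} ℓ → (c + d ρ) ≡ (c′ + d′ ρ) ⊗ ι (+ ℓ) →
  + 7 ≤ N (c + d ρ) → ¬ AssociateOfInteger (c + d ρ) →
  ∃ λ n₀ → N (c′ + d′ ρ) ≡ + (2 ℕ.+ n₀)
norm-at-least-2 {c} {d} {c′} {d′} ℓ α≡ 7≤N not-associate = by-norm (norm-nonneg (c′ + d′ ρ))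
  where
  norm-scale : N (c + d ρ) ≡ (+ ℓ * + ℓ) * N (c′ + d′ ρ)
  norm-scale = norm-factor {α′ = c′ + d′ ρ} ℓ α≡
  by-norm : (∃ λ m → N (c′ + d′ ρ) ≡ + m) → ∃ λ n₀ → N (c′ + d′ ρ) ≡ + (2 ℕ.+ n₀)
  by-norm (zero , N≡0) = ⊥-elim (7≰0 (subst (+ 7 ≤_) (trans norm-scale (trans (cong (+ ℓ * + ℓ *_) N≡0)
                                                      (ℤP.*-zeroʳ (+ ℓ * + ℓ)))) 7≤N))
    where
    7≰0 : ¬ (+ 7 ≤ + 0)
    7≰0 (ℤ.+≤+ ())
  by-norm (suc zero , N≡1) = ⊥-elim (not-associate (+ ℓ , j , (begin
    c + d ρ                    ≡⟨ α≡ ⟩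
    (c′ + d′ ρ) ⊗ ι (+ ℓ)      ≡⟨ cong (_⊗ ι (+ ℓ)) α′≡ρʲ ⟩
    ρ^ j ⊗ ι (+ ℓ)             ≡⟨ ⊗-comm (ρ^ j) (ι (+ ℓ)) ⟩
    ι (+ ℓ) ⊗ ρ^ j             ∎)))
    where
    open ≡-Reasoning
    j : ℕ
    j = proj₁ (norm-one (c′ + d′ ρ) N≡1)
    α′≡ρʲ : (c′ + d′ ρ) ≡ ρ^ j
    α′≡ρʲ = proj₂ (norm-one (c′ + d′ ρ) N≡1)
  by-norm (suc (suc n₀) , N≡n) = n₀ , N≡n

six-invertible : ∀ M n L → M %ℕ 6 ≡ 1 → M ≡ L * + n → Congruence.Invertible n (+ 6)
six-invertible M n L M%6≡1 M≡ = - (M /ℕ 6) , Congruence.mk (- L , (begin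
  + 6 * - (M /ℕ 6) - + 1                 ≡⟨ regroup (M /ℕ 6) ⟩
  - (+ 1 + (M /ℕ 6) * + 6)               ≡⟨ cong (λ k → - (+ k + (M /ℕ 6) * + 6)) (sym M%6≡1) ⟩
  - (+ (M %ℕ 6) + (M /ℕ 6) * + 6)        ≡⟨ cong -_ (sym (a≡a%ℕn+[a/ℕn]*n M 6)) ⟩
  - M                                    ≡⟨ cong -_ M≡ ⟩
  - (L * + n)                            ≡⟨ ℤP.neg-distribˡ-* L (+ n) ⟩
  - L * + n                              ∎))
  where
  open ≡-Reasoning
  regroup : ∀ q → + 6 * - q - + 1 ≡ - (+ 1 + q * + 6)
  regroup = solve-∀

corollary4p2 : (c d : ℤ) →
    + 7 ≤ N (c + d ρ) → N (c + d ρ) %ℕ 6 ≡ 1 →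
    ¬ AssociateOfInteger (c + d ρ) →
    (c′ d′ : ℤ) →
    c ≡ + gcd ∣ c ∣ ∣ d ∣ * c′ → d ≡ + gcd ∣ c ∣ ∣ d ∣ * d′ →
    ∃ λ (n : ℕ) → ∃ λ (H : ℤ → Set) → ∃ λ (a : ℤ) →
    FirstKindFrobCirc6 n H a ×
    Cover (gcd ∣ c ∣ ∣ d ∣ ^ 2) (EJ (c + d ρ)) (Cay n (Orbit n H a)) ×
    Iso (Cay n (Orbit n H a)) (EJ (c′ + d′ ρ))
corollary4p2 c d 7≤N N%6≡1 not-associate c′ d′ hc hd =
  R.n , R.H , + 1 , R.first-kind ,
  subst (λ γ → Cover (ℓ ^ 2) (EJ γ) (Cay R.n R.Orbit₁)) (sym α≡) C.covering , R.iso
  where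
  ℓ : ℕ
  ℓ = gcd ∣ c ∣ ∣ d ∣
  α≡ : (c + d ρ) ≡ (c′ + d′ ρ) ⊗ ι (+ ℓ)
  α≡ = factorisation ℓ hc hd
  norm-scale : N (c + d ρ) ≡ (+ ℓ * + ℓ) * N (c′ + d′ ρ)
  norm-scale = norm-factor {α′ = c′ + d′ ρ} ℓ α≡
  instance
    ℓ-nonzero : ℕ.NonZero ℓ
    ℓ-nonzero = scale-nonzero ℓ (N (c′ + d′ ρ)) (subst (+ 7 ≤_) norm-scale 7≤N)
  bezout′ : ∃ λ s → ∃ λ t → s * c′ + t * d′ ≡ + 1
  bezout′ = coprime-parts {c} {d} {c′} {d′} hc hd
  large : ∃ λ n₀ → N (c′ + d′ ρ) ≡ + (2 ℕ.+ n₀)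
  large = norm-at-least-2 {c} {d} {c′} {d′} ℓ α≡ 7≤N not-associate
  module R = Reduction c′ d′ (proj₁ bezout′) (proj₁ (proj₂ bezout′)) (proj₂ (proj₂ bezout′))
                       (proj₁ large) (proj₂ large)
                       (six-invertible (N (c + d ρ)) _ (+ ℓ * + ℓ) N%6≡1
                         (trans norm-scale (cong (+ ℓ * + ℓ *_) (proj₂ large))))
  module C = R.Covering ℓ
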